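{- Let $\sigma$ be a signature and $\varphi$ a $\mathcal{CO}_{\sqcup}[\sigma]$- or $\mathcal{COD}[\sigma]$-formula. (i) For any causal team $T=(T^-,\mathcal F)$ over $\sigma$, $T\models^c\varphi$ iff $T^g\models^g\varphi$, where $T^g=\{(s,\mathcal F)\mid s\in T^-\}$. (ii) For any nonempty generalized causal team $T$ over $\sigma$ all of whose elements have the same function component $\mathcal F$, $T\models^g\varphi$ iff $T^c\models^c\varphi$, where $T^c=(T^-,\mathcal F)$.
   Context: Signature $\sigma=(\mathrm{Dom},\mathrm{Ran})$: nonempty finite set of variables, each with a nonempty finite range. Assignments $s$ with $s(X)\in\mathrm{Ran}(X)$; $\mathbb A_\sigma$ their set. A system of functions $\mathcal F$ assigns to each $V\in\mathrm{En}(\mathcal F)\subseteq\mathrm{Dom}$ a set $PA_V^{\mathcal F}\subseteq\mathrm{Dom}\setminus\{V\}$ and $\mathcal F_V:\mathrm{Ran}(PA_V^{\mathcal F})\to\mathrm{Ran}(V)$; recursive if the graph with edges $(X,Y)$, $X\in PA_Y^{\mathcal F}$, is acyclic; $s$ compatible with $\mathcal F$ if $s(V)=\mathcal F_V(s(PA_V^{\mathcal F}))$ for $V\in\mathrm{En}(\mathcal F)$. Causal team: $(T^-,\mathcal F)$, $\mathcal F$ recursive, $T^-\subseteq\mathbb A_\sigma$ of compatible assignments; causal subteam: $(S^-,\mathcal F)$ with $S^-\subseteq T^-$. Generalized causal team: a set $T$ of pairs $(s,\mathcal F)$ with $\mathcal F$ recursive and $s$ compatible with $\mathcal F$; causal subteams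 are subsets; $T^-=\{s\mid(s,\mathcal F)\in T\}$. $\mathbf X=\mathbf x$ abbreviates a conjunction of equations, consistent if no variable gets two distinct values. Intervention (consistent $\mathbf X=\mathbf x$): $\mathcal F_{\mathbf X=\mathbf x}$ = restriction of $\mathcal F$ to $\mathrm{En}(\mathcal F)\setminus\mathbf X$; $s_{\mathbf X=\mathbf x}(X_i)=x_i$, $s_{\mathbf X=\mathbf x}(V)=s(V)$ for $V\notin\mathrm{En}(\mathcal F)\cup\mathbf X$, $s_{\mathbf X=\mathbf x}(V)=\mathcal F_V(s_{\mathbf X=\mathbf x}(PA_V^{\mathcal F}))$ recursively otherwise; for causal teams $T_{\mathbf X=\mathbf x}=(\{s_{\mathbf X=\mathbf x}\mid s\in T^-\},\mathcal F_{\mathbf X=\mathbf x})$, for generalized ones $T_{\mathbf X=\mathbf x}=\{(s_{\mathbf X=\mathbf x},\mathcal F_{\mathbf X=\mathbf x})\mid(s,\mathcal F)\in T\}$. Languages: $\mathcal{CO}[\sigma]$: $\alpha::=X=x\mid\neg\alpha\mid\alpha\wedge\alpha\mid\alpha\vee\alpha\mid\mathbf X=\mathbf x\ \Box\!\!\rightarrow\alpha$; $\mathcal{CO}_{\sqcup}[\sigma]$ adds $\varphi\sqcup\varphi$; $\mathcal{COD}[\sigma]$ adds dependence atoms $=\!(\mathbf X;Y)$ (in both, negation only on $\mathcal{CO}[\sigma]$-formulas). Causal-team semantics $\models^c$ on $T=(T^-,\mathcal F)$: $T\models X=x$ iff $s(X)=x$ for all $s\in T^-$; $T\models\ =\!(\mathbf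 X;Y)$ iff for all $s,s'\in T^-$, $s(\mathbf X)=s'(\mathbf X)$ implies $s(Y)=s'(Y)$; $T\models\neg\alpha$ iff $(\{s\},\mathcal F)\not\models\alpha$ for all $s\in T^-$; $\wedge$ usual; $T\models\varphi\vee\psi$ iff causal subteams $T_1,T_2$ with $T_1^-\cup T_2^-=T^-$, $T_1\models\varphi$, $T_2\models\psi$ exist; $T\models\varphi\sqcup\psi$ iff $T\models\varphi$ or $T\models\psi$; $T\models\mathbf X=\mathbf x\ \Box\!\!\rightarrow\varphi$ iff $\mathbf X=\mathbf x$ inconsistent or $T_{\mathbf X=\mathbf x}\models\varphi$. Generalized semantics $\models^g$: same clauses (atoms and dependence atoms read via $T^-$), except $T\models^g\neg\alpha$ iff $\{(s,\mathcal F)\}\not\models^g\alpha$ for all $(s,\mathcal F)\in T$, and $T\models^g\varphi\vee\psi$ iff $T=T_1\cup T_2$ with $T_1\models^g\varphi$, $T_2\models^g\psi$. -}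

module Defs where

open import Level using (Level; 0ℓ; Lift) renaming (suc to lsuc)
open import Data.Nat using (ℕ; NonZero)
open import Data.Fin using (Fin) renaming (_≟_ to _≟ᶠ_)
open import Data.Bool using (Bool; true; false; _∧_; not)
open import Data.List using (List)
open import Data.List.Membership.Propositional using (_∈_)
open import Data.List.Relation.Unary.Any using (any?)
open import Data.Product using (Σ; ∃; _×_; _,_; proj₁)
open import Data.Sum using (_⊎_)
open import Relation.Nullary using (¬_)
open import Relation.Nullary.Decidable using (⌊_⌋)
open import Relation.Binary.PropositionalEquality using (_≡_)
open import Relation.Binary.Construct.Closure.Transitive using (TransClosure)

-- Signatures: Dom = Fin nVars (nonempty), Ran(X) = Fin (ran X) (nonempty)

record Signature : Set where
  field
    nVars    : ℕ
    ran      : Fin nVars → ℕ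
    nonempty : NonZero nVars
    ranNonempty : (X : Fin nVars) → NonZero (ran X)

-- which language: pure = CO[σ],  sq = CO_⊔[σ],  dep = COD[σ]
data Ext : Set where
  pure sq dep : Ext

module _ (σ : Signature) where
  open Signature σ

  Var : Set
  Var = Fin nVars

  Val : Var → Set
  Val X = Fin (ran X)

  Assignment : Set
  Assignment = (X : Var) → Val X

  -- En is the set of endogenous variables,
  -- PA V X = true  iff  X ∈ PA_V,  and  fn V  is F_V, given as a function
  -- of the whole assignment that depends only on the values of PA_V
  -- (i.e. a function Ran(PA_V) → Ran(V)).  PA and fn are only meaningful
  -- for V ∈ En; extensional equality of systems (_≈S_) ignores them otherwise.
  record System : Set where
    field
      En       : Var → Bool
      PA       : Var → Var → Bool
      PA-irr   : (V : Var) → PA V V ≡ false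
      fn       : (V : Var) → Assignment → Val V
      fn-local : (V : Var) (s t : Assignment) →
                 ((X : Var) → PA V X ≡ true → s X ≡ t X) → fn V s ≡ fn V t
  open System public

  _≈S_ : System → System → Set
  F ≈S G = (V : Var) → (En F V ≡ En G V) ×
           (En F V ≡ true → ((X : Var) → PA F V X ≡ PA G V X) ×
                            ((s : Assignment) → fn F V s ≡ fn G V s))

  Edge : System → Var → Var → Set
  Edge F X Y = (En F Y ≡ true) × (PA F Y X ≡ true)

  Recursive : System → Set
  Recursive F = (X : Var) → ¬ TransClosure (Edge F) X X

  Compatible : System → Assignment → Set
  Compatible F s = (V : Var) → En F V ≡ true → s V ≡ fn F V s

  -- conjunctions of equations  X₁ = x₁ ∧ … ∧ Xₖ = xₖ

  Eqs : Set
  Eqs = List (Σ Var Val)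

  Consistent : Eqs → Set
  Consistent E = (p q : Σ Var Val) → p ∈ E → q ∈ E → proj₁ p ≡ proj₁ q → p ≡ q

  inE : Eqs → Var → Bool
  inE E V = ⌊ any? (λ p → proj₁ p ≟ᶠ V) E ⌋

  restrict : System → Eqs → System
  restrict F E = record
    { En = λ V → En F V ∧ not (inE E V)
    ; PA = PA F ; PA-irr = PA-irr F ; fn = fn F ; fn-local = fn-local F }

  -- IntSol F E s t : t = s_{X=x}, expressed by the defining equations
  -- (which, for recursive F, have exactly one solution, namely the
  -- recursively defined s_{X=x}).
  IntSol : System → Eqs → Assignment → Assignment → Set
  IntSol F E s t =
    ((X : Var) (x : Val X) → (X , x) ∈ E → t X ≡ x) ×
    ((V : Var) → inE E V ≡ false → En F V ≡ false → t V ≡ s V) ×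
    ((V : Var) → inE E V ≡ false → En F V ≡ true → t V ≡ fn F V t)

  infixr 6 _∧ᶠ_
  infixr 5 _∨ᶠ_ _⊔ᶠ_
  data Fml : Ext → Set where
    _≐_   : ∀ {e} (X : Var) → Val X → Fml e
    ¬ᶠ_   : ∀ {e} → Fml pure → Fml e
    _∧ᶠ_  : ∀ {e} → Fml e → Fml e → Fml e
    _∨ᶠ_  : ∀ {e} → Fml e → Fml e → Fml e
    _□→_  : ∀ {e} → Eqs → Fml e → Fml e
    _⊔ᶠ_  : Fml sq → Fml sq → Fml sq
    =⟨_⨾_⟩ : List Var → Var → Fml dep

  Team : Set₁
  Team = Assignment → Set

  GTeam : Set₁
  GTeam = Assignment × System → Set

  IsCausalTeam : Team → System → Set
  IsCausalTeam T F = Recursive F × ((s : Assignment) → T s → Compatible F s)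

  IsGenTeam : GTeam → Set
  IsGenTeam T = (s : Assignment) (F : System) → T (s , F) → Recursive F × Compatible F s

  intC : Team → System → Eqs → Team
  intC T F E t = ∃ λ s → T s × IntSol F E s t

  intG : GTeam → Eqs → GTeam
  intG T E (t , G′) = ∃ λ s → ∃ λ G → T (s , G) × IntSol G E s t × (G′ ≡ restrict G E)

  minus : GTeam → Team
  minus T s = ∃ λ F → T (s , F)

  toGen : Team → System → GTeam
  toGen T F (s , G) = T s × (G ≡ F)

  satC : ∀ {e} → Team → System → Fml e → Set₁
  satC T F (X ≐ x) = Lift (lsuc 0ℓ) ((s : Assignment) → T s → s X ≡ x)
  satC T F (¬ᶠ α) = (s : Assignment) → T s → ¬ satC (λ t → t ≡ s) F α
  satC T F (φ ∧ᶠ ψ) = satC T F φ × satC T F ψ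
  satC T F (φ ∨ᶠ ψ) = Σ Team λ T₁ → Σ Team λ T₂ →
    ((s : Assignment) → T₁ s → T s) × ((s : Assignment) → T₂ s → T s) ×
    ((s : Assignment) → T s → T₁ s ⊎ T₂ s) × satC T₁ F φ × satC T₂ F ψ
  satC T F (E □→ φ) = ¬ Consistent E ⊎ satC (intC T F E) (restrict F E) φ
  satC T F (φ ⊔ᶠ ψ) = satC T F φ ⊎ satC T F ψ
  satC T F =⟨ Xs ⨾ Y ⟩ = Lift (lsuc 0ℓ) ((s s′ : Assignment) → T s → T s′ →
    ((X : Var) → X ∈ Xs → s X ≡ s′ X) → s Y ≡ s′ Y)

  satG : ∀ {e} → GTeam → Fml e → Set₁
  satG T (X ≐ x) = Lift (lsuc 0ℓ) ((s : Assignment) → minus T s → s X ≡ x)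
  satG T (¬ᶠ α) = (p : Assignment × System) → T p → ¬ satG (λ q → q ≡ p) α
  satG T (φ ∧ᶠ ψ) = satG T φ × satG T ψ
  satG T (φ ∨ᶠ ψ) = Σ GTeam λ T₁ → Σ GTeam λ T₂ →
    ((p : Assignment × System) → T₁ p → T p) × ((p : Assignment × System) → T₂ p → T p) ×
    ((p : Assignment × System) → T p → T₁ p ⊎ T₂ p) × satG T₁ φ × satG T₂ ψ
  satG T (E □→ φ) = ¬ Consistent E ⊎ satG (intG T E) φ
  satG T (φ ⊔ᶠ ψ) = satG T φ ⊎ satG T ψ
  satG T =⟨ Xs ⨾ Y ⟩ = Lift (lsuc 0ℓ) ((s s′ : Assignment) → minus T s → minus T s′ →
    ((X : Var) → X ∈ Xs → s X ≡ s′ X) → s Y ≡ s′ Y)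

module Submission where

-- Both parts are instances of one transfer theorem.  Say that a causal team
-- (T , F) is *represented* by a generalized team T' when T' has exactly the
-- assignments of T (T'⁻ = T) and every function component of T' is
-- extensionally equal (≈S) to F.  By induction on φ, representation implies
-- (T , F) ⊨ᶜ φ ⇔ T' ⊨ᵍ φ.  The induction goes through because
-- representation is stable under everything the semantic clauses do to a
-- team: passing to a singleton (negation), splitting into subteams
-- (disjunction) and intervening (□→).  For the last step we first show that
-- interventions only depend on a system of functions up to ≈S.
-- Part (i) is the case T' = T^g, part (ii) the case T = T'⁻.

open import Defs
open import Data.Bool using (true; false; _∧_; not)
open import Data.Product using (∃; _×_; _,_; proj₁; proj₂)
import Data.Sum as Sum
open import Function.Bundles using (_⇔_; mk⇔; Equivalence)
open import Function.Properties.Equivalence using () renaming (sym to ⇔-sym)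
open import Level using (lift; lower)
open import Relation.Binary.PropositionalEquality using (_≡_; refl; sym; trans; cong)

module Transfer (σ : Signature) where
  open Equivalence

  ≈S-refl : (F : System σ) → _≈S_ σ F F
  ≈S-refl F V = refl , λ _ → (λ _ → refl) , (λ _ → refl)

  ≈S-sym : {F G : System σ} → _≈S_ σ F G → _≈S_ σ G F
  ≈S-sym {F} {G} F≈G V with F≈G V
  ... | sameEn , sameOnEn =
    sym sameEn ,
    λ enG → let (samePA , sameFn) = sameOnEn (trans sameEn enG)
            in (λ X → sym (samePA X)) , (λ s → sym (sameFn s))

  -- Restricted systems have En(V) ∧ ¬(V ∈ X); endogeneity there implies it in F.
  ∧-true-left : ∀ {a b} → a ∧ b ≡ true → a ≡ true
  ∧-true-left {true}  _ = refl
  ∧-true-left {false} ()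

  restrict-cong : {F G : System σ} (E : Eqs σ) →
                  _≈S_ σ F G → _≈S_ σ (restrict σ F E) (restrict σ G E)
  restrict-cong E F≈G V with F≈G V
  ... | sameEn , sameOnEn =
    cong (λ b → b ∧ not (inE σ E V)) sameEn ,
    λ enFE → sameOnEn (∧-true-left enFE)

  IntSol-cong : {F G : System σ} (E : Eqs σ) {s t : Assignment σ} →
                _≈S_ σ F G → IntSol σ F E s t → IntSol σ G E s t
  IntSol-cong E {t = t} F≈G (setVars , exoVars , endoVars) =
    setVars ,
    (λ V notSet exoG → exoVars V notSet (trans (proj₁ (F≈G V)) exoG)) ,
    (λ V notSet endoG →
       let endoF = trans (proj₁ (F≈G V)) endoG
       in trans (endoVars V notSet endoF) (proj₂ (proj₂ (F≈G V) endoF) t))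

  record Represents (T : Team σ) (F : System σ) (T' : GTeam σ) : Set where
    field
      sound    : (s : Assignment σ) → minus σ T' s → T s
      complete : (s : Assignment σ) → T s → minus σ T' s
      uniform  : (s : Assignment σ) (G : System σ) → T' (s , G) → _≈S_ σ G F
  open Represents

  represents-toGen : (T : Team σ) (F : System σ) → Represents T F (toGen σ T F)
  represents-toGen T F = record
    { sound    = λ { _ (_ , inT , _) → inT }
    ; complete = λ s inT → F , inT , refl
    ; uniform  = λ { _ _ (_ , refl) → ≈S-refl F } }

  represents-minus : {F : System σ} (T' : GTeam σ) →
    ((s : Assignment σ) (G : System σ) → T' (s , G) → _≈S_ σ G F) →
    Represents (minus σ T') F T'
  represents-minus T' uni = record
    { sound = λ _ inT → inT ; complete = λ _ inT → inT ; uniform = uni }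

  represents-singleton : {T : Team σ} {F : System σ} {T' : GTeam σ} →
    Represents T F T' → (s : Assignment σ) (G : System σ) → T' (s , G) →
    Represents (λ t → t ≡ s) F (λ q → q ≡ (s , G))
  represents-singleton rep s G inT' = record
    { sound    = λ { _ (_ , refl) → refl }
    ; complete = λ { _ refl → G , refl }
    ; uniform  = λ { _ _ refl → uniform rep s G inT' } }

  represents-subteam : {T T₁ : Team σ} {F : System σ} {T' : GTeam σ} →
    Represents T F T' → ((s : Assignment σ) → T₁ s → T s) →
    Represents T₁ F (λ p → T' p × T₁ (proj₁ p))
  represents-subteam rep T₁⊆T = record
    { sound    = λ { _ (_ , _ , inT₁) → inT₁ }
    ; complete = λ s inT₁ → let (G , inT') = complete rep s (T₁⊆T s inT₁)
                            in G , inT' , inT₁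
    ; uniform  = λ s G inT'T₁ → uniform rep s G (proj₁ inT'T₁) }

  represents-intervention : {T : Team σ} {F : System σ} {T' : GTeam σ}
    (E : Eqs σ) → Represents T F T' →
    Represents (intC σ T F E) (restrict σ F E) (intG σ T' E)
  represents-intervention {F = F} E rep = record
    { sound    = λ { t (_ , s , G , inT' , sol , _) →
                     s , sound rep s (G , inT') , IntSol-cong {G} {F} E (uniform rep s G inT') sol }
    ; complete = λ { t (s , inT , sol) →
                     let (G , inT') = complete rep s inT
                     in restrict σ G E , s , G , inT' ,
                        IntSol-cong {F} {G} E (≈S-sym {G} {F} (uniform rep s G inT')) sol , refl }
    ; uniform  = λ { t _ (s , G , inT' , _ , refl) →
                     restrict-cong {G} {F} E (uniform rep s G inT') } }

  transfer : ∀ {e} (φ : Fml σ e) {T : Team σ} {F : System σ} {T' : GTeam σ} →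
             Represents T F T' → satC σ T F φ ⇔ satG σ T' φ
  transfer (X ≐ x) rep =
    mk⇔ (λ h → lift λ s inT' → lower h s (sound rep s inT'))
        (λ h → lift λ s inT → lower h s (complete rep s inT))
  transfer =⟨ Xs ⨾ Y ⟩ rep =
    mk⇔ (λ h → lift λ s s′ inT inT′ → lower h s s′ (sound rep s inT) (sound rep s′ inT′))
        (λ h → lift λ s s′ inT inT′ → lower h s s′ (complete rep s inT) (complete rep s′ inT′))
  transfer (φ ∧ᶠ ψ) rep =
    mk⇔ (λ (a , b) → to (transfer φ rep) a , to (transfer ψ rep) b)
        (λ (a , b) → from (transfer φ rep) a , from (transfer ψ rep) b)
  transfer (φ ⊔ᶠ ψ) rep =
    mk⇔ (Sum.map (to (transfer φ rep)) (to (transfer ψ rep)))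
        (Sum.map (from (transfer φ rep)) (from (transfer ψ rep)))
  transfer (E □→ φ) rep =
    mk⇔ (Sum.map₂ (to (transfer φ (represents-intervention E rep))))
        (Sum.map₂ (from (transfer φ (represents-intervention E rep))))
  transfer {e} (¬ᶠ α) {T} {F} {T'} rep = mk⇔ toG toC
    where
      atSingleton : (s : Assignment σ) (G : System σ) → T' (s , G) →
                    satC σ (λ t → t ≡ s) F α ⇔ satG σ (λ q → q ≡ (s , G)) α
      atSingleton s G inT' = transfer α (represents-singleton rep s G inT')

      toG : satC σ T F (¬ᶠ_ {e = e} α) → satG σ T' (¬ᶠ_ {e = e} α)
      toG h (s , G) inT' sat = h s (sound rep s (G , inT')) (from (atSingleton s G inT') sat)

      toC : satG σ T' (¬ᶠ_ {e = e} α) → satC σ T F (¬ᶠ_ {e = e} α)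
      toC h s inT sat = let (G , inT') = complete rep s inT
                        in h (s , G) inT' (to (atSingleton s G inT') sat)
  transfer (φ ∨ᶠ ψ) {T} {F} {T'} rep = mk⇔ toG toC
    where
      -- split T' along the assignments of the causal split T₁ ∪ T₂
      toG : satC σ T F (φ ∨ᶠ ψ) → satG σ T' (φ ∨ᶠ ψ)
      toG (T₁ , T₂ , T₁⊆T , T₂⊆T , cover , sat₁ , sat₂) =
        (λ p → T' p × T₁ (proj₁ p)) , (λ p → T' p × T₂ (proj₁ p)) ,
        (λ _ → proj₁) , (λ _ → proj₁) ,
        (λ { (s , G) inT' → Sum.map (inT' ,_) (inT' ,_) (cover s (sound rep s (G , inT'))) }) ,
        to (transfer φ (represents-subteam rep T₁⊆T)) sat₁ ,
        to (transfer ψ (represents-subteam rep T₂⊆T)) sat₂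

      -- a generalized split T'₁ ∪ T'₂ induces the causal split T'₁⁻ ∪ T'₂⁻
      toC : satG σ T' (φ ∨ᶠ ψ) → satC σ T F (φ ∨ᶠ ψ)
      toC (T'₁ , T'₂ , T'₁⊆T' , T'₂⊆T' , cover , sat₁ , sat₂) =
        minus σ T'₁ , minus σ T'₂ ,
        (λ { s (G , inT'₁) → sound rep s (G , T'₁⊆T' _ inT'₁) }) ,
        (λ { s (G , inT'₂) → sound rep s (G , T'₂⊆T' _ inT'₂) }) ,
        (λ s inT → let (G , inT') = complete rep s inT
                   in Sum.map (G ,_) (G ,_) (cover (s , G) inT')) ,
        from (transfer φ (represents-minus T'₁ λ s G x → uniform rep s G (T'₁⊆T' _ x))) sat₁ ,
        from (transfer ψ (represents-minus T'₂ λ s G x → uniform rep s G (T'₂⊆T' _ x))) sat₂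

open Transfer using (transfer; represents-toGen; represents-minus)

lemma2p11 : (σ : Signature) →
    ((e : Ext) (φ : Fml σ e) (T : Team σ) (F : System σ) →
      IsCausalTeam σ T F →
      (satC σ T F φ ⇔ satG σ (toGen σ T F) φ))
    ×
    ((e : Ext) (φ : Fml σ e) (T : GTeam σ) (F : System σ) →
      IsGenTeam σ T →
      (∃ λ p → T p) →
      ((s : Assignment σ) (G : System σ) → T (s , G) → _≈S_ σ G F) →
      (satG σ T φ ⇔ satC σ (minus σ T) F φ))
lemma2p11 σ = partI , partII
  where
    partI : (e : Ext) (φ : Fml σ e) (T : Team σ) (F : System σ) →
            IsCausalTeam σ T F → satC σ T F φ ⇔ satG σ (toGen σ T F) φ
    partI e φ T F _ = transfer σ φ (represents-toGen σ T F)

    partII : (e : Ext) (φ : Fml σ e) (T : GTeam σ) (F : System σ) →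
             IsGenTeam σ T → (∃ λ p → T p) →
             ((s : Assignment σ) (G : System σ) → T (s , G) → _≈S_ σ G F) →
             satG σ T φ ⇔ satC σ (minus σ T) F φ
    partII e φ T F _ _ uniform = ⇔-sym (transfer σ φ (represents-minus σ {F} T uniform))
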